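{- The T rule is admissible in $\mathbf{HR}$: every hypersequent that has a derivation in $\mathbf{HR}$ has a derivation in $\mathbf{HR}$ that contains no instance of the T rule.
   Context: Terms. Fix a countable set of variables $x,y,z,\dots$. Terms (in negation normal form) are generated by $A ::= x \mid \overline{x} \mid 0 \mid A+A \mid rA \mid A\sqcup A \mid A\sqcap A$, where $x$ is a variable, $\overline{x}$ is the corresponding negated variable, and $r\in\mathbb{R}_{>0}$. The negation $\overline{A}$ of a term is defined by $\overline{x}$ (for $x$), $\overline{\overline{x}}=x$, $\overline{0}=0$, $\overline{A+B}=\overline{A}+\overline{B}$, $\overline{rA}=r\overline{A}$, $\overline{A\sqcup B}=\overline{A}\sqcap\overline{B}$, $\overline{A\sqcap B}=\overline{A}\sqcup\overline{B}$. A weighted term is $r.A$ with $r\in\mathbb{R}_{>0}$; a sequent $\vdash\Gamma$ has $\Gamma$ a finite (possibly empty) multiset of weighted terms; a hypersequent is a nonempty finite multiset of sequents, written $\vdash\Gamma_1\mid\cdots\mid\vdash\Gamma_n$, and $G\mid\vdash\Gamma$ denotes $G$ with the sequent $\vdash\Gamma$ added. For a finite (possibly empty) sequence $\vec r=(r_1,\dots,r_n)$ of strictly positive reals, $\vec r.A$ is the multiset $r_1.A,\dots,r_n.A$, $\sum\vec r=r_1+\dots+r_n$, and $s\vec r=(sr_1,\dots,sr_n)$; $s.\Gamma$ multiplies every weight in $\Gamma$ by $s>0$. The calculus $\mathbf{HR}$ has the rules (vectors are finite sequences of strictly positive reals): INIT: $\vdash$ with no premises. W: from $G$ infer $G\mid\vdash\Gamma$.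 C: from $G\mid\vdash\Gamma\mid\vdash\Gamma$ infer $G\mid\vdash\Gamma$. S: from $G\mid\vdash\Gamma_1,\Gamma_2$ infer $G\mid\vdash\Gamma_1\mid\vdash\Gamma_2$. M: from $G\mid\vdash\Gamma_1$ and $G\mid\vdash\Gamma_2$ infer $G\mid\vdash\Gamma_1,\Gamma_2$. T: for $r>0$, from $G\mid\vdash r.\Gamma$ infer $G\mid\vdash\Gamma$. ID: if $\sum\vec r=\sum\vec s$, from $G\mid\vdash\Gamma$ infer $G\mid\vdash\Gamma,\vec r.x,\vec s.\overline{x}$. 0: from $G\mid\vdash\Gamma$ infer $G\mid\vdash\Gamma,\vec r.0$. $+$: from $G\mid\vdash\Gamma,\vec r.A,\vec r.B$ infer $G\mid\vdash\Gamma,\vec r.(A+B)$. $\times$: from $G\mid\vdash\Gamma,(s\vec r).A$ infer $G\mid\vdash\Gamma,\vec r.(sA)$. $\sqcup$: from $G\mid\vdash\Gamma,\vec r.A\mid\vdash\Gamma,\vec r.B$ infer $G\mid\vdash\Gamma,\vec r.(A\sqcup B)$. $\sqcap$: from $G\mid\vdash\Gamma,\vec r.A$ and $G\mid\vdash\Gamma,\vec r.B$ infer $G\mid\vdash\Gamma,\vec r.(A\sqcap B)$. CAN: if $\sum\vec r=\sum\vec s$, from $G\mid\vdash\Gamma,\vec s.A,\vec r.\overline{A}$ infer $G\mid\vdash\Gamma$. A derivation is a finite tree of rule instances whose leaves are INIT. -}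

module Defs where

open import Level using (0ℓ)
open import Data.Nat using (ℕ)
open import Data.Bool using (Bool; true; false)
open import Data.Product using (Σ; ∃; _×_; _,_)
open import Data.Sum using (_⊎_)
open import Data.List using (List; []; _∷_; _++_; map; foldr)
open import Relation.Nullary using (¬_)
open import Relation.Binary.PropositionalEquality using (_≡_)
open import Relation.Binary.Structures using (IsStrictTotalOrder)
open import Algebra.Structures using (IsCommutativeRing)
import Data.List.Relation.Binary.Permutation.Propositional as PermP
import Data.List.Relation.Binary.Permutation.Homogeneous as PermH

-- The real numbers, axiomatised as a Dedekind-complete ordered field
-- (any model is isomorphic to ℝ).  The standard library has no reals.

record RealField : Set₁ where
  infixl 6 _+_
  infixl 7 _*_
  infix 4 _<_ _≤_
  field
    Carrier : Set
    0# 1#   : Carrier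
    _+_ _*_ : Carrier → Carrier → Carrier
    -_      : Carrier → Carrier
    _<_     : Carrier → Carrier → Set
    isCommutativeRing : IsCommutativeRing _≡_ _+_ _*_ -_ 0# 1#
    isStrictTotalOrder : IsStrictTotalOrder _≡_ _<_
    0<1     : 0# < 1#
    inverse : ∀ x → ¬ (x ≡ 0#) → ∃ λ y → x * y ≡ 1#
    +-mono-< : ∀ {x y} z → x < y → x + z < y + z
    *-pos   : ∀ {x y} → 0# < x → 0# < y → 0# < x * y

  _≤_ : Carrier → Carrier → Set
  x ≤ y = x < y ⊎ x ≡ y

  field
    complete : (P : Carrier → Set) → ∃ P → (∃ λ b → ∀ x → P x → x ≤ b) →
               ∃ λ s → (∀ x → P x → x ≤ s) × (∀ b → (∀ x → P x → x ≤ b) → s ≤ b)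

module HR (ℝ : RealField) where
  open RealField ℝ using (Carrier; 0#; _<_) renaming (_+_ to _+ℝ_; _*_ to _*ℝ_)

  record ℝ⁺ : Set where
    constructor pos
    field
      val   : Carrier
      .0<val : 0# < val
  open ℝ⁺ public

  _·⁺_ : ℝ⁺ → ℝ⁺ → ℝ⁺
  pos a p ·⁺ pos b q = pos (a *ℝ b) (RealField.*-pos ℝ p q)

  -- Terms in negation normal form; variables are natural numbers

  infixl 6 _⊕_
  data Term : Set where
    var   : ℕ → Term
    covar : ℕ → Term
    𝟘     : Term
    _⊕_   : Term → Term → Term
    _⊙_   : ℝ⁺ → Term → Term
    _⊔_   : Term → Term → Term
    _⊓_   : Term → Term → Term

  neg : Term → Term
  neg (var x)   = covar x
  neg (covar x) = var x
  neg 𝟘         = 𝟘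
  neg (A ⊕ B)   = neg A ⊕ neg B
  neg (r ⊙ A)   = r ⊙ neg A
  neg (A ⊔ B)   = neg A ⊓ neg B
  neg (A ⊓ B)   = neg A ⊔ neg B

  -- weighted terms r.A, sequents (multisets, as lists up to permutation),
  -- hypersequents (multisets of sequents, as lists up to permutation)
  WTerm : Set
  WTerm = ℝ⁺ × Term

  Sequent : Set
  Sequent = List WTerm

  Hyper : Set
  Hyper = List Sequent

  _≈ₛ_ : Sequent → Sequent → Set
  _≈ₛ_ = PermP._↭_

  _≈ₕ_ : Hyper → Hyper → Set
  _≈ₕ_ = PermH.Permutation _≈ₛ_

  Vec⁺ : Set
  Vec⁺ = List ℝ⁺

  Σ⃗ : Vec⁺ → Carrier
  Σ⃗ = foldr (λ r acc → val r +ℝ acc) 0#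

  _·⃗_ : ℝ⁺ → Vec⁺ → Vec⁺
  s ·⃗ rs = map (s ·⁺_) rs

  _∙_ : Vec⁺ → Term → Sequent
  rs ∙ A = map (λ r → r , A) rs

  _∙ₛ_ : ℝ⁺ → Sequent → Sequent
  s ∙ₛ Γ = map (λ { (r , A) → (s ·⁺ r) , A }) Γ

  -- The flag says whether the T rule may be used:
  -- HR-Deriv true H  : H has an HR derivation;
  -- HR-Deriv false H : H has an HR derivation with no instance of T.
  -- Conclusions "G | ⊢ Γ" are written Γ ∷ G; multisets are handled by
  -- the constructor `perm` (conversion along multiset equality).

  data HR-Deriv : Bool → Hyper → Set where
    perm : ∀ {t H H'} → H ≈ₕ H' → HR-Deriv t H → HR-Deriv t H'
    INIT : ∀ {t} → HR-Deriv t ([] ∷ [])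
    W    : ∀ {t G Γ} → HR-Deriv t G → HR-Deriv t (Γ ∷ G)
    C    : ∀ {t G Γ} → HR-Deriv t (Γ ∷ Γ ∷ G) → HR-Deriv t (Γ ∷ G)
    S    : ∀ {t G Γ₁ Γ₂} → HR-Deriv t ((Γ₁ ++ Γ₂) ∷ G) → HR-Deriv t (Γ₁ ∷ Γ₂ ∷ G)
    M    : ∀ {t G Γ₁ Γ₂} → HR-Deriv t (Γ₁ ∷ G) → HR-Deriv t (Γ₂ ∷ G) →
           HR-Deriv t ((Γ₁ ++ Γ₂) ∷ G)
    T    : ∀ {G Γ} (r : ℝ⁺) → HR-Deriv true ((r ∙ₛ Γ) ∷ G) → HR-Deriv true (Γ ∷ G)
    ID   : ∀ {t G Γ} (x : ℕ) (rs ss : Vec⁺) → Σ⃗ rs ≡ Σ⃗ ss →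
           HR-Deriv t (Γ ∷ G) → HR-Deriv t ((Γ ++ rs ∙ var x ++ ss ∙ covar x) ∷ G)
    ZERO : ∀ {t G Γ} (rs : Vec⁺) → HR-Deriv t (Γ ∷ G) → HR-Deriv t ((Γ ++ rs ∙ 𝟘) ∷ G)
    PLUS : ∀ {t G Γ} (rs : Vec⁺) (A B : Term) →
           HR-Deriv t ((Γ ++ rs ∙ A ++ rs ∙ B) ∷ G) → HR-Deriv t ((Γ ++ rs ∙ (A ⊕ B)) ∷ G)
    TIMES : ∀ {t G Γ} (rs : Vec⁺) (s : ℝ⁺) (A : Term) →
           HR-Deriv t ((Γ ++ (s ·⃗ rs) ∙ A) ∷ G) → HR-Deriv t ((Γ ++ rs ∙ (s ⊙ A)) ∷ G)
    JOIN : ∀ {t G Γ} (rs : Vec⁺) (A B : Term) →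
           HR-Deriv t ((Γ ++ rs ∙ A) ∷ (Γ ++ rs ∙ B) ∷ G) → HR-Deriv t ((Γ ++ rs ∙ (A ⊔ B)) ∷ G)
    MEET : ∀ {t G Γ} (rs : Vec⁺) (A B : Term) →
           HR-Deriv t ((Γ ++ rs ∙ A) ∷ G) → HR-Deriv t ((Γ ++ rs ∙ B) ∷ G) →
           HR-Deriv t ((Γ ++ rs ∙ (A ⊓ B)) ∷ G)
    CAN  : ∀ {t G Γ} (rs ss : Vec⁺) (A : Term) → Σ⃗ rs ≡ Σ⃗ ss →
           HR-Deriv t ((Γ ++ ss ∙ A ++ rs ∙ neg A) ∷ G) → HR-Deriv t (Γ ∷ G)

-- It suffices to remove one T at the root of a T-free derivation of ⊢ r.Γ | G.
-- If r > 1, pack Γ into the single term E = Σ rᵢAᵢ; passing from ⊢ c.E to ⊢ 1.E for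
-- c > 1 needs only a cut on c.(E ⊔ 0), and CAN with the identity unpacks E again.
-- If r < 1, scale the whole derivation by 1/r, which is admissible rule by rule: this
-- restores Γ and multiplies every other sequent of G by 1/r > 1, removed as before.

module Submission where

open import Defs
open import Data.Bool using (Bool; true; false)
open import Data.Product using (Σ; _×_; _,_)
open import Data.Empty using (⊥-elim)
import Data.Empty.Irrelevant as Irrelevant
open import Data.List using ([]; _∷_; _++_; [_]; map)
import Data.List.Properties as List
open import Function using (_∘_)
open import Relation.Binary.PropositionalEquality
  using (_≡_; refl; sym; trans; cong; cong₂; subst; subst₂; module ≡-Reasoning)
open import Relation.Nullary using (¬_)
open import Relation.Binary.Definitions using (tri<; tri≈; tri>)
open import Algebra.Structures using (IsCommutativeRing)
open import Algebra.Bundles using (CommutativeRing)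
open import Relation.Binary.Structures using (IsStrictTotalOrder)
open import Data.List.Relation.Binary.Permutation.Propositional
  using (_↭_; ↭-refl; ↭-sym; prep; swap)
import Data.List.Relation.Binary.Permutation.Propositional.Properties as ↭
import Data.List.Relation.Binary.Permutation.Homogeneous as Permutationʰ
import Data.List.Relation.Binary.Pointwise as Pointwise

module T-Elimination (ℝ : RealField) where
  open RealField ℝ
  open IsCommutativeRing isCommutativeRing
    using (+-assoc; +-comm; +-identityˡ; +-identityʳ; -‿inverseˡ; -‿inverseʳ;
           *-comm; *-assoc; *-identityˡ; *-identityʳ; distribˡ; zeroʳ)
  open IsStrictTotalOrder isStrictTotalOrder using (compare; irrefl) renaming (trans to <-trans)

  commutativeRing : CommutativeRing _ _
  commutativeRing = record { isCommutativeRing = isCommutativeRing }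

  open import Algebra.Properties.Ring (CommutativeRing.ring commutativeRing) using (-‿distribʳ-*)
  open HR ℝ
  open ≡-Reasoning

  y-x+x≡y : ∀ x y → y + - x + x ≡ y
  y-x+x≡y x y = begin
    y + - x + x    ≡⟨ +-assoc y (- x) x ⟩
    y + (- x + x)  ≡⟨ cong (y +_) (-‿inverseˡ x) ⟩
    y + 0#         ≡⟨ +-identityʳ y ⟩
    y              ∎

  x<y⇒0<y-x : ∀ {x y} → x < y → 0# < y + - x
  x<y⇒0<y-x {x} {y} x<y = subst (_< y + - x) (-‿inverseʳ x) (+-mono-< (- x) x<y)

  0<y-x⇒x<y : ∀ {x y} → 0# < y + - x → x < y
  0<y-x⇒x<y {x} {y} 0<y-x = subst₂ _<_ (+-identityˡ x) (y-x+x≡y x y) (+-mono-< x 0<y-x)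

  ¬0<-1 : ¬ (0# < - 1#)
  ¬0<-1 0<-1 = irrefl refl (<-trans 0<1 1<0)
    where
    1<0 : 1# < 0#
    1<0 = 0<y-x⇒x<y (subst (0# <_) (sym (+-identityˡ (- 1#))) 0<-1)

  x*y≡1⇒0<y : ∀ {x y} → 0# < x → x * y ≡ 1# → 0# < y
  x*y≡1⇒0<y {x} {y} 0<x xy≡1 with compare 0# y
  ... | tri< 0<y _ _ = 0<y
  ... | tri≈ _ 0≡y _ = ⊥-elim (irrefl 0≡1 0<1)
    where
    0≡1 : 0# ≡ 1#
    0≡1 = trans (sym (zeroʳ x)) (trans (cong (x *_) 0≡y) xy≡1)
  ... | tri> _ _ y<0 = ⊥-elim (¬0<-1 (subst (0# <_) x*-y≡-1 (*-pos 0<x 0<-y)))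
    where
    0<-y : 0# < - y
    0<-y = subst (0# <_) (+-identityˡ (- y)) (x<y⇒0<y-x y<0)
    x*-y≡-1 : x * - y ≡ - 1#
    x*-y≡-1 = trans (sym (-‿distribʳ-* x y)) (cong -_ xy≡1)

  x<1⇒1<y : ∀ {x y} → x < 1# → 0# < y → x * y ≡ 1# → 1# < y
  x<1⇒1<y {x} {y} x<1 0<y xy≡1 =
    0<y-x⇒x<y (subst (0# <_) y[1-x]≡y-1 (*-pos 0<y (x<y⇒0<y-x x<1)))
    where
    y[1-x]≡y-1 : y * (1# + - x) ≡ y + - 1#
    y[1-x]≡y-1 = begin
      y * (1# + - x)     ≡⟨ distribˡ y 1# (- x) ⟩
      y * 1# + y * - x   ≡⟨ cong₂ _+_ (*-identityʳ y) (sym (-‿distribʳ-* y x)) ⟩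
      y + - (y * x)      ≡⟨ cong (λ z → y + - z) (trans (*-comm y x) xy≡1) ⟩
      y + - 1#           ∎

  -- The positivity proof of an ℝ⁺ is irrelevant; trichotomy recovers a usable one.
  positive : (r : ℝ⁺) → 0# < val r
  positive (pos r 0<r) with compare 0# r
  ... | tri< 0<r′ _ _ = 0<r′
  ... | tri≈ _ 0≡r _  = Irrelevant.⊥-elim (irrefl 0≡r 0<r)
  ... | tri> _ _ r<0  = Irrelevant.⊥-elim (irrefl refl (<-trans 0<r r<0))

  ℝ⁺-≡ : ∀ {r s : ℝ⁺} → val r ≡ val s → r ≡ s
  ℝ⁺-≡ refl = refl

  1⁺ : ℝ⁺
  1⁺ = pos 1# 0<1

  ·⁺-comm : ∀ r s → r ·⁺ s ≡ s ·⁺ r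
  ·⁺-comm r s = ℝ⁺-≡ (*-comm (val r) (val s))

  reciprocal>1 : (r : ℝ⁺) → val r < 1# → Σ ℝ⁺ λ t → 1# < val t × val t * val r ≡ 1#
  reciprocal>1 r r<1 with inverse (val r) (λ r≡0 → irrefl (sym r≡0) (positive r))
  ... | y , r*y≡1 = pos y 0<y , x<1⇒1<y r<1 0<y r*y≡1 , trans (*-comm y (val r)) r*y≡1
    where
    0<y : 0# < y
    0<y = x*y≡1⇒0<y (positive r) r*y≡1

  Σ⃗-·⃗ : ∀ t rs → Σ⃗ (t ·⃗ rs) ≡ val t * Σ⃗ rs
  Σ⃗-·⃗ t []       = sym (zeroʳ (val t))
  Σ⃗-·⃗ t (r ∷ rs) = begin
    val t * val r + Σ⃗ (t ·⃗ rs)    ≡⟨ cong (val t * val r +_) (Σ⃗-·⃗ t rs) ⟩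
    val t * val r + val t * Σ⃗ rs  ≡⟨ sym (distribˡ (val t) (val r) (Σ⃗ rs)) ⟩
    val t * (val r + Σ⃗ rs)        ∎

  Σ⃗-·⃗-≡ : ∀ t rs ss → Σ⃗ rs ≡ Σ⃗ ss → Σ⃗ (t ·⃗ rs) ≡ Σ⃗ (t ·⃗ ss)
  Σ⃗-·⃗-≡ t rs ss eq = trans (Σ⃗-·⃗ t rs) (trans (cong (val t *_) eq) (sym (Σ⃗-·⃗ t ss)))

  ∙ₛ-++ : ∀ t Γ Δ → t ∙ₛ (Γ ++ Δ) ≡ t ∙ₛ Γ ++ t ∙ₛ Δ
  ∙ₛ-++ t Γ Δ = List.map-++ _ Γ Δ

  ∙ₛ-∙ : ∀ t rs A → t ∙ₛ (rs ∙ A) ≡ (t ·⃗ rs) ∙ A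
  ∙ₛ-∙ t []       A = refl
  ∙ₛ-∙ t (r ∷ rs) A = cong (_ ∷_) (∙ₛ-∙ t rs A)

  ∙ₛ-∙ₛ : ∀ t r Γ → t ∙ₛ (r ∙ₛ Γ) ≡ (t ·⁺ r) ∙ₛ Γ
  ∙ₛ-∙ₛ t r []            = refl
  ∙ₛ-∙ₛ t r ((w , A) ∷ Γ) =
    cong₂ _∷_ (cong (_, A) (ℝ⁺-≡ (sym (*-assoc (val t) (val r) (val w))))) (∙ₛ-∙ₛ t r Γ)

  ∙ₛ-identity : ∀ r → val r ≡ 1# → ∀ Γ → r ∙ₛ Γ ≡ Γ
  ∙ₛ-identity r r≡1 []            = refl
  ∙ₛ-identity r r≡1 ((w , A) ∷ Γ) =
    cong₂ _∷_ (cong (_, A) (ℝ⁺-≡ (trans (cong (_* val w) r≡1) (*-identityˡ (val w))))) (∙ₛ-identity r r≡1 Γ)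

  ∙ₛ-comm : ∀ t r Γ → t ∙ₛ (r ∙ₛ Γ) ≡ r ∙ₛ (t ∙ₛ Γ)
  ∙ₛ-comm t r Γ = begin
    t ∙ₛ (r ∙ₛ Γ)  ≡⟨ ∙ₛ-∙ₛ t r Γ ⟩
    (t ·⁺ r) ∙ₛ Γ  ≡⟨ cong (_∙ₛ Γ) (·⁺-comm t r) ⟩
    (r ·⁺ t) ∙ₛ Γ  ≡⟨ sym (∙ₛ-∙ₛ r t Γ) ⟩
    r ∙ₛ (t ∙ₛ Γ)  ∎

  ·⃗-comm : ∀ t s rs → t ·⃗ (s ·⃗ rs) ≡ s ·⃗ (t ·⃗ rs)
  ·⃗-comm t s []       = refl
  ·⃗-comm t s (r ∷ rs) = cong₂ _∷_ (ℝ⁺-≡ (begin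
    val t * (val s * val r)  ≡⟨ sym (*-assoc (val t) (val s) (val r)) ⟩
    val t * val s * val r    ≡⟨ cong (_* val r) (*-comm (val t) (val s)) ⟩
    val s * val t * val r    ≡⟨ *-assoc (val s) (val t) (val r) ⟩
    val s * (val t * val r)  ∎)) (·⃗-comm t s rs)

  ∙ₛ-↭ : ∀ t {Γ Δ} → Γ ↭ Δ → t ∙ₛ Γ ↭ t ∙ₛ Δ
  ∙ₛ-↭ t = ↭.map⁺ _

  ∙ₛ-≈ₕ : ∀ t {H H′} → H ≈ₕ H′ → map (t ∙ₛ_) H ≈ₕ map (t ∙ₛ_) H′
  ∙ₛ-≈ₕ t (Permutationʰ.refl ps)     = Permutationʰ.refl (Pointwise.map⁺ _ _ (Pointwise.map (∙ₛ-↭ t) ps))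
  ∙ₛ-≈ₕ t (Permutationʰ.prep p ps)   = Permutationʰ.prep (∙ₛ-↭ t p) (∙ₛ-≈ₕ t ps)
  ∙ₛ-≈ₕ t (Permutationʰ.swap p q ps) = Permutationʰ.swap (∙ₛ-↭ t p) (∙ₛ-↭ t q) (∙ₛ-≈ₕ t ps)
  ∙ₛ-≈ₕ t (Permutationʰ.trans ps qs) = Permutationʰ.trans (∙ₛ-≈ₕ t ps) (∙ₛ-≈ₕ t qs)

  ∙ₛ-principal : ∀ t Γ rs A → t ∙ₛ (Γ ++ rs ∙ A) ≡ t ∙ₛ Γ ++ (t ·⃗ rs) ∙ A
  ∙ₛ-principal t Γ rs A = trans (∙ₛ-++ t Γ (rs ∙ A)) (cong (t ∙ₛ Γ ++_) (∙ₛ-∙ t rs A))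

  ∙ₛ-principal₂ : ∀ t Γ rs A ss B →
                  t ∙ₛ (Γ ++ rs ∙ A ++ ss ∙ B) ≡ t ∙ₛ Γ ++ (t ·⃗ rs) ∙ A ++ (t ·⃗ ss) ∙ B
  ∙ₛ-principal₂ t Γ rs A ss B = trans (∙ₛ-++ t Γ (rs ∙ A ++ ss ∙ B))
    (cong (t ∙ₛ Γ ++_) (trans (∙ₛ-principal t (rs ∙ A) ss B) (cong (_++ (t ·⃗ ss) ∙ B) (∙ₛ-∙ t rs A))))

  private variable
    b : Bool
    G : Hyper
    Γ Δ Π : Sequent
    A B E : Term
    r c : ℝ⁺

  ≈ₕ-refl : ∀ {H} → H ≈ₕ H
  ≈ₕ-refl = Permutationʰ.refl (Pointwise.refl ↭-refl)

  ≈ₕ-sym : ∀ {H H′} → H ≈ₕ H′ → H′ ≈ₕ H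
  ≈ₕ-sym = Permutationʰ.sym ↭-sym

  shiftʰ : ∀ Δ G K → (G ++ Δ ∷ K) ≈ₕ (Δ ∷ G ++ K)
  shiftʰ Δ []      K = ≈ₕ-refl
  shiftʰ Δ (Γ ∷ G) K =
    Permutationʰ.trans (Permutationʰ.prep ↭-refl (shiftʰ Δ G K)) (Permutationʰ.swap ↭-refl ↭-refl ≈ₕ-refl)

  permHead : Γ ↭ Δ → HR-Deriv b (Γ ∷ G) → HR-Deriv b (Δ ∷ G)
  permHead p = perm (Permutationʰ.prep p ≈ₕ-refl)

  castHead : Γ ≡ Δ → HR-Deriv b (Γ ∷ G) → HR-Deriv b (Δ ∷ G)
  castHead refl d = d

  swapTerms : ∀ {x y} → HR-Deriv b ((x ∷ y ∷ Γ) ∷ G) → HR-Deriv b ((y ∷ x ∷ Γ) ∷ G)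
  swapTerms = permHead (swap _ _ ↭-refl)

  swapSequents : HR-Deriv b (Γ ∷ Δ ∷ G) → HR-Deriv b (Δ ∷ Γ ∷ G)
  swapSequents = perm (Permutationʰ.swap ↭-refl ↭-refl ≈ₕ-refl)

  empty-sequent : ∀ G → HR-Deriv b ([] ∷ G)
  empty-sequent []      = INIT
  empty-sequent (Γ ∷ G) = swapSequents (W (empty-sequent G))

  atFront : ∀ Π Π′ → (HR-Deriv b ((Γ ++ Π) ∷ G) → HR-Deriv b ((Γ ++ Π′) ∷ G)) →
            HR-Deriv b ((Π ++ Γ) ∷ G) → HR-Deriv b ((Π′ ++ Γ) ∷ G)
  atFront {Γ = Γ} Π Π′ rule = permHead (↭.++-comm Γ Π′) ∘ rule ∘ permHead (↭.++-comm Π Γ)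

  ZERO-front : HR-Deriv b (Γ ∷ G) → HR-Deriv b (((r , 𝟘) ∷ Γ) ∷ G)
  ZERO-front {Γ = Γ} {r = r} = permHead (↭.++-comm Γ [ r , 𝟘 ]) ∘ ZERO [ r ]

  PLUS-front : HR-Deriv b (((r , A) ∷ (r , B) ∷ Γ) ∷ G) → HR-Deriv b (((r , A ⊕ B) ∷ Γ) ∷ G)
  PLUS-front {r = r} {A = A} {B = B} = atFront ((r , A) ∷ (r , B) ∷ []) [ r , A ⊕ B ] (PLUS [ r ] A B)

  TIMES-front : ∀ {s} → HR-Deriv b (((s ·⁺ r , A) ∷ Γ) ∷ G) → HR-Deriv b (((r , s ⊙ A) ∷ Γ) ∷ G)
  TIMES-front {r = r} {A = A} {s = s} = atFront [ s ·⁺ r , A ] [ r , s ⊙ A ] (TIMES [ r ] s A)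

  ⊔-introˡ : HR-Deriv b (((r , A) ∷ Γ) ∷ G) → HR-Deriv b (((r , A ⊔ B) ∷ Γ) ∷ G)
  ⊔-introˡ {r = r} {A = A} {B = B} = atFront [ r , A ] [ r , A ⊔ B ] (JOIN [ r ] A B ∘ swapSequents ∘ W)

  ⊔-introʳ : HR-Deriv b (((r , B) ∷ Γ) ∷ G) → HR-Deriv b (((r , A ⊔ B) ∷ Γ) ∷ G)
  ⊔-introʳ {r = r} {B = B} {A = A} = atFront [ r , B ] [ r , A ⊔ B ] (JOIN [ r ] A B ∘ W)

  open import Algebra.Solver.CommutativeMonoid (↭.++-commutativeMonoid {A = WTerm})
    using (solve; _⊜_) renaming (_⊕_ to _⧺_)

  identity : ∀ w A → HR-Deriv b (((w , A) ∷ (w , neg A) ∷ []) ∷ G)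
  identity w (var x)   = ID {Γ = []} x [ w ] [ w ] refl (empty-sequent _)
  identity w (covar x) = swapTerms (ID {Γ = []} x [ w ] [ w ] refl (empty-sequent _))
  identity w 𝟘         = ZERO-front (ZERO-front (empty-sequent _))
  identity w (A ⊕ B)   =
    PLUS-front (permHead (↭.∷↭∷ʳ _ _) (PLUS-front (permHead π (M (identity w A) (identity w B)))))
    where
    π : (w , A) ∷ (w , neg A) ∷ (w , B) ∷ (w , neg B) ∷ [] ↭
        (w , neg A) ∷ (w , neg B) ∷ (w , A) ∷ (w , B) ∷ []
    π = solve 4 (λ a ā b b̄ → a ⧺ ā ⧺ b ⧺ b̄ ⊜ ā ⧺ b̄ ⧺ a ⧺ b) ↭-refl
          [ w , A ] [ w , neg A ] [ w , B ] [ w , neg B ]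
  identity w (s ⊙ A)   = TIMES-front (swapTerms (TIMES-front (swapTerms (identity (s ·⁺ w) A))))
  identity w (A ⊔ B)   =
    MEET {Γ = [ w , A ⊔ B ]} [ w ] (neg A) (neg B) (⊔-introˡ (identity w A)) (⊔-introʳ (identity w B))
  identity w (A ⊓ B)   = swapTerms (MEET {Γ = [ w , neg A ⊔ neg B ]} [ w ] A B
    (⊔-introˡ (swapTerms (identity w A))) (⊔-introʳ (swapTerms (identity w B))))

  negₛ : Sequent → Sequent
  negₛ = map λ (w , A) → w , neg A

  identity-sequent : ∀ Γ → HR-Deriv b ((Γ ++ negₛ Γ) ∷ G)
  identity-sequent []            = empty-sequent _
  identity-sequent ((w , A) ∷ Γ) =
    permHead (prep _ (↭-sym (↭.shift _ Γ (negₛ Γ)))) (M (identity w A) (identity-sequent Γ))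

  split-weight : ∀ {r₁ r₂} → val r₁ + val r₂ ≡ val r →
                 HR-Deriv b (((r , A) ∷ Δ) ∷ G) → HR-Deriv b (((r₁ , A) ∷ (r₂ , A) ∷ Δ) ∷ G)
  split-weight {r = r} {A = A} {Δ = Δ} {r₁ = r₁} {r₂} r₁+r₂≡r d =
    CAN (r₁ ∷ r₂ ∷ []) [ r ] A Σ-eq (permHead π (M d (M (identity r₁ A) (identity r₂ A))))
    where
    Σ-eq : val r₁ + (val r₂ + 0#) ≡ val r + 0#
    Σ-eq = trans (cong (val r₁ +_) (+-identityʳ (val r₂))) (trans r₁+r₂≡r (sym (+-identityʳ (val r))))
    π : (r , A) ∷ Δ ++ (r₁ , A) ∷ (r₁ , neg A) ∷ (r₂ , A) ∷ (r₂ , neg A) ∷ [] ↭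
        (r₁ , A) ∷ (r₂ , A) ∷ Δ ++ (r , A) ∷ (r₁ , neg A) ∷ (r₂ , neg A) ∷ []
    π = solve 6 (λ x Δ x₁ x̄₁ x₂ x̄₂ → x ⧺ Δ ⧺ x₁ ⧺ x̄₁ ⧺ x₂ ⧺ x̄₂ ⊜ x₁ ⧺ x₂ ⧺ Δ ⧺ x ⧺ x̄₁ ⧺ x̄₂) ↭-refl
          [ r , A ] Δ [ r₁ , A ] [ r₁ , neg A ] [ r₂ , A ] [ r₂ , neg A ]

  asTerm : Sequent → Term
  asTerm []            = 𝟘
  asTerm ((w , A) ∷ Γ) = w ⊙ A ⊕ asTerm Γ

  asTerm-negₛ : ∀ Γ → asTerm (negₛ Γ) ≡ neg (asTerm Γ)
  asTerm-negₛ []            = refl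
  asTerm-negₛ ((w , A) ∷ Γ) = cong (w ⊙ neg A ⊕_) (asTerm-negₛ Γ)

  asTerm-intro : ∀ s Γ → HR-Deriv b ((s ∙ₛ Γ ++ Δ) ∷ G) → HR-Deriv b (((s , asTerm Γ) ∷ Δ) ∷ G)
  asTerm-intro s []            d = ZERO-front d
  asTerm-intro {b = b} {Δ = Δ} {G = G} s ((w , A) ∷ Γ) d =
    PLUS-front (swapTerms (asTerm-intro s Γ
      (permHead (↭-sym (↭.shift _ (s ∙ₛ Γ) Δ)) (TIMES-front (subst Weighted (·⁺-comm s w) d)))))
    where
    Weighted : ℝ⁺ → Set
    Weighted u = HR-Deriv b (((u , A) ∷ s ∙ₛ Γ ++ Δ) ∷ G)

  asTerm-elim : HR-Deriv b ([ 1⁺ , asTerm Γ ] ∷ G) → HR-Deriv b (Γ ∷ G)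
  asTerm-elim {b = b} {Γ = Γ} {G = G} d =
    CAN {Γ = Γ} [ 1⁺ ] [ 1⁺ ] (asTerm Γ) refl (permHead (↭.++-comm (_ ∷ _ ∷ []) Γ) (M d negated))
    where
    negated : HR-Deriv b (((1⁺ , neg (asTerm Γ)) ∷ Γ) ∷ G)
    negated = subst (λ X → HR-Deriv b (((1⁺ , X) ∷ Γ) ∷ G)) (asTerm-negₛ Γ)
      (asTerm-intro 1⁺ (negₛ Γ)
        (castHead (cong (_++ Γ) (sym (∙ₛ-identity 1⁺ refl (negₛ Γ))))
          (permHead (↭.++-comm Γ (negₛ Γ)) (identity-sequent Γ))))

  -- Writing c = 1 + c′, cut c.(E ⊔ 0) against 1.(E ⊔ 0), c′.(E ⊔ 0); in both branches of
  -- the resulting c.(Ē ⊓ 0) the join E ⊔ 0 is read as 0 for weight 1 and as E for weight c′,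
  -- leaving the splits of c.E and of the identity c.E, c.Ē.
  shrink-term : 1# < val c → HR-Deriv b ([ c , E ] ∷ G) → HR-Deriv b ([ 1⁺ , E ] ∷ G)
  shrink-term {c = c} {b = b} {E = E} {G = G} 1<c d =
    CAN {Γ = [ 1⁺ , E ]} [ c ] (1⁺ ∷ c′ ∷ []) (E ⊔ 𝟘) Σ-eq
      (MEET {Γ = (1⁺ , E) ∷ (1⁺ , E ⊔ 𝟘) ∷ (c′ , E ⊔ 𝟘) ∷ []} [ c ] (neg E) 𝟘
        (positive-parts (split-weight c′+1≡c (identity c E)))
        (ZERO [ c ] (positive-parts (split-weight c′+1≡c d))))
    where
    c′ : ℝ⁺
    c′ = pos (val c + - 1#) (x<y⇒0<y-x 1<c)
    c′+1≡c : val c + - 1# + 1# ≡ val c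
    c′+1≡c = y-x+x≡y 1# (val c)
    Σ-eq : val c + 0# ≡ 1# + (val c + - 1# + 0#)
    Σ-eq = begin
      val c + 0#                ≡⟨ +-identityʳ (val c) ⟩
      val c                     ≡⟨ sym c′+1≡c ⟩
      val c + - 1# + 1#         ≡⟨ +-comm _ 1# ⟩
      1# + (val c + - 1#)       ≡⟨ cong (1# +_) (sym (+-identityʳ _)) ⟩
      1# + (val c + - 1# + 0#)  ∎
    positive-parts : HR-Deriv b (((c′ , E) ∷ (1⁺ , E) ∷ Π) ∷ G) →
                     HR-Deriv b (((1⁺ , E) ∷ (1⁺ , E ⊔ 𝟘) ∷ (c′ , E ⊔ 𝟘) ∷ Π) ∷ G)
    positive-parts = permHead (↭.shift _ (_ ∷ _ ∷ []) _) ∘ ⊔-introʳ ∘ ZERO-front ∘ ⊔-introˡ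

  shrink : ∀ c → 1# < val c → HR-Deriv b ((c ∙ₛ Γ) ∷ G) → HR-Deriv b (Γ ∷ G)
  shrink {Γ = Γ} c 1<c =
    asTerm-elim ∘ shrink-term 1<c ∘ asTerm-intro c Γ ∘ castHead (sym (List.++-identityʳ (c ∙ₛ Γ)))

  shrink-all : ∀ c → 1# < val c → ∀ K G → HR-Deriv b (K ++ map (c ∙ₛ_) G) → HR-Deriv b (K ++ G)
  shrink-all c 1<c K []      d = d
  shrink-all c 1<c K (Δ ∷ G) d =
    perm (≈ₕ-sym (shiftʰ Δ K G))
      (shrink-all c 1<c (Δ ∷ K) G (shrink c 1<c (perm (shiftʰ (c ∙ₛ Δ) K (map (c ∙ₛ_) G)) d)))

  scale : ∀ t {H} → HR-Deriv b H → HR-Deriv b (map (t ∙ₛ_) H)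
  scale t (perm p d)                 = perm (∙ₛ-≈ₕ t p) (scale t d)
  scale t INIT                       = INIT
  scale t (W d)                      = W (scale t d)
  scale t (C d)                      = C (scale t d)
  scale t (S {Γ₁ = Γ₁} {Γ₂} d)       = S (castHead (∙ₛ-++ t Γ₁ Γ₂) (scale t d))
  scale t (M {Γ₁ = Γ₁} {Γ₂} d e)     = castHead (sym (∙ₛ-++ t Γ₁ Γ₂)) (M (scale t d) (scale t e))
  scale t (T {Γ = Γ} r d)            = T r (castHead (∙ₛ-comm t r Γ) (scale t d))
  scale t (ID {Γ = Γ} x rs ss eq d)  = castHead (sym (∙ₛ-principal₂ t Γ rs (var x) ss (covar x)))
    (ID x (t ·⃗ rs) (t ·⃗ ss) (Σ⃗-·⃗-≡ t rs ss eq) (scale t d))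
  scale t (ZERO {Γ = Γ} rs d)        = castHead (sym (∙ₛ-principal t Γ rs 𝟘)) (ZERO (t ·⃗ rs) (scale t d))
  scale t (PLUS {Γ = Γ} rs A B d)    = castHead (sym (∙ₛ-principal t Γ rs (A ⊕ B)))
    (PLUS (t ·⃗ rs) A B (castHead (∙ₛ-principal₂ t Γ rs A rs B) (scale t d)))
  scale t (TIMES {Γ = Γ} rs s A d)   = castHead (sym (∙ₛ-principal t Γ rs (s ⊙ A)))
    (TIMES (t ·⃗ rs) s A (castHead (trans (∙ₛ-principal t Γ (s ·⃗ rs) A)
      (cong (λ us → t ∙ₛ Γ ++ us ∙ A) (·⃗-comm t s rs))) (scale t d)))
  scale {b = b} t (JOIN {G = G} {Γ = Γ} rs A B d) = castHead (sym (∙ₛ-principal t Γ rs (A ⊔ B)))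
    (JOIN (t ·⃗ rs) A B (subst (HR-Deriv b)
      (cong₂ (λ Γ₁ Γ₂ → Γ₁ ∷ Γ₂ ∷ map (t ∙ₛ_) G) (∙ₛ-principal t Γ rs A) (∙ₛ-principal t Γ rs B))
      (scale t d)))
  scale t (MEET {Γ = Γ} rs A B d e)  = castHead (sym (∙ₛ-principal t Γ rs (A ⊓ B)))
    (MEET (t ·⃗ rs) A B (castHead (∙ₛ-principal t Γ rs A) (scale t d))
                        (castHead (∙ₛ-principal t Γ rs B) (scale t e)))
  scale t (CAN {Γ = Γ} rs ss A eq d) =
    CAN (t ·⃗ rs) (t ·⃗ ss) A (Σ⃗-·⃗-≡ t rs ss eq) (castHead (∙ₛ-principal₂ t Γ ss A rs (neg A)) (scale t d))

  grow : ∀ r → val r < 1# → HR-Deriv b ((r ∙ₛ Γ) ∷ G) → HR-Deriv b (Γ ∷ G)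
  grow {Γ = Γ} {G = G} r r<1 d with reciprocal>1 r r<1
  ... | t , 1<t , t*r≡1 = shrink-all t 1<t [ Γ ] G (castHead t∙r∙Γ≡Γ (scale t d))
    where
    t∙r∙Γ≡Γ : t ∙ₛ (r ∙ₛ Γ) ≡ Γ
    t∙r∙Γ≡Γ = trans (∙ₛ-∙ₛ t r Γ) (∙ₛ-identity (t ·⁺ r) t*r≡1 Γ)

  T-admissible : ∀ r → HR-Deriv false ((r ∙ₛ Γ) ∷ G) → HR-Deriv false (Γ ∷ G)
  T-admissible {Γ = Γ} r d with compare (val r) 1#
  ... | tri< r<1 _ _ = grow r r<1 d
  ... | tri≈ _ r≡1 _ = castHead (∙ₛ-identity r r≡1 Γ) d
  ... | tri> _ _ 1<r = shrink r 1<r d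

  eliminate-T : ∀ {H} → HR-Deriv true H → HR-Deriv false H
  eliminate-T (perm p d)         = perm p (eliminate-T d)
  eliminate-T INIT               = INIT
  eliminate-T (W d)              = W (eliminate-T d)
  eliminate-T (C d)              = C (eliminate-T d)
  eliminate-T (S d)              = S (eliminate-T d)
  eliminate-T (M d e)            = M (eliminate-T d) (eliminate-T e)
  eliminate-T (T r d)            = T-admissible r (eliminate-T d)
  eliminate-T (ID x rs ss eq d)  = ID x rs ss eq (eliminate-T d)
  eliminate-T (ZERO rs d)        = ZERO rs (eliminate-T d)
  eliminate-T (PLUS rs A B d)    = PLUS rs A B (eliminate-T d)
  eliminate-T (TIMES rs s A d)   = TIMES rs s A (eliminate-T d)
  eliminate-T (JOIN rs A B d)    = JOIN rs A B (eliminate-T d)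
  eliminate-T (MEET rs A B d e)  = MEET rs A B (eliminate-T d) (eliminate-T e)
  eliminate-T (CAN rs ss A eq d) = CAN rs ss A eq (eliminate-T d)

corollary3p30 : (ℝ : RealField) → let open HR ℝ in
    ∀ (H : Hyper) → HR-Deriv true H → HR-Deriv false H
corollary3p30 ℝ _ = T-Elimination.eliminate-T ℝ
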